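{- Let $n\ge1$ be an integer and let $C$ be a finite set of points in the plane in convex position, with the total order $\prec$ described below. If a $2$-colouring of the edges of the complete geometric graph $K_C$ contains a monochromatic well-split complete bipartite graph $K_{2n^2,2n^2}$, then it contains a monochromatic non-crossing copy of the ladder graph $L_{2n}$.
   Context: The points of $C$ (the vertices of a convex polygon) are labelled $v_1,\dots,v_{|C|}$ in clockwise order starting from an arbitrary vertex, and $v_i\prec v_j$ iff $i<j$. For $A,B\subseteq C$, write $A\prec B$ if $u\prec v$ for all $u\in A$, $v\in B$. For disjoint $L,R\subseteq C$, $K_{L,R}$ denotes the set of edges $\{u,v\}$ with $u\in L$, $v\in R$; it is well-split if $L\prec R$ or $R\prec L$; a well-split $K_{a,b}$ is a well-split $K_{L,R}$ with $|L|=a$, $|R|=b$, and it is monochromatic if all its edges have the same colour. The complete geometric graph $K_C$ has vertex set $C$ and straight-line segments as edges. The ladder graph $L_{2n}$ consists of two paths $u_1\cdots u_n$ and $v_1\cdots v_n$ plus the edges $\{u_i,v_i\}$, $i\in[n]$. A non-crossing copy of a graph $G$ is a subgraph of $K_C$ isomorphic to $G$ whose edges pairwise intersect only at common endpoints. -}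

module Defs where

open import Data.Nat using (ℕ; suc; _*_)
open import Data.Fin using (Fin; _<_; suc; zero)
open import Data.Fin.Subset using (Subset; _∈_; ∣_∣)
open import Data.Bool using (Bool; true; false)
open import Data.Product using (_×_; Σ; ∃; ∃-syntax)
open import Data.Sum using (_⊎_)
open import Relation.Binary.PropositionalEquality using (_≡_; _≢_)
open import Relation.Nullary using (¬_)
open import Function.Definitions using (Injective)

-- The convex point set C is modelled by its labels Fin N (v₁,…,v_N clockwise);
-- the order ≺ is the order on Fin N.

Colouring : ℕ → Set
Colouring N = Fin N → Fin N → Bool

Symmetric : ∀ {N} → Colouring N → Set
Symmetric c = ∀ u v → c u v ≡ c v u

_≺_ : ∀ {N} → Subset N → Subset N → Set
A ≺ B = ∀ u v → u ∈ A → v ∈ B → u < v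

WellSplit : ∀ {N} → Subset N → Subset N → Set
WellSplit L R = L ≺ R ⊎ R ≺ L

MonoBip : ∀ {N} → Colouring N → Bool → Subset N → Subset N → Set
MonoBip c col L R = ∀ u v → u ∈ L → v ∈ R → c u v ≡ col

HasMonoWellSplit : ∀ {N} → Colouring N → ℕ → ℕ → Set
HasMonoWellSplit {N} c a b =
  Σ Bool λ col → Σ (Subset N) λ L → Σ (Subset N) λ R →
    ∣ L ∣ ≡ a × ∣ R ∣ ≡ b × WellSplit L R × MonoBip c col L R

-- Crossing of segments for points in convex position, in terms of labels.
-- x strictly between a and b (in label order)
Btw : ∀ {N} → Fin N → Fin N → Fin N → Set
Btw x a b = (a < x × x < b) ⊎ (b < x × x < a)

Out : ∀ {N} → Fin N → Fin N → Fin N → Set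
Out x a b = ((x < a) × (x < b)) ⊎ ((a < x) × (b < x))

-- segments ab and cd cross (properly, i.e. not at a common endpoint)
Cross : ∀ {N} → Fin N → Fin N → Fin N → Fin N → Set
Cross a b c d = (Btw c a b × Out d a b) ⊎ (Out c a b × Btw d a b)

-- The ladder graph L_{2n}: vertices u_i (false,i) and v_i (true,i), i ∈ Fin n.
LVert : ℕ → Set
LVert n = Bool × Fin n

data LEdge {n : ℕ} : LVert n → LVert n → Set where
  rail  : ∀ (s : Bool) (i : Fin n) {j : Fin n} →
          Data.Fin.toℕ j ≡ suc (Data.Fin.toℕ i) → LEdge (s Data.Product., i) (s Data.Product., j)
  rung  : ∀ (i : Fin n) → LEdge (false Data.Product., i) (true Data.Product., i)

HasMonoNCLadder : ∀ {N} → Colouring N → ℕ → Set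
HasMonoNCLadder {N} c n =
  Σ Bool λ col → Σ (LVert n → Fin N) λ f →
    Injective _≡_ _≡_ f ×
    (∀ x y → LEdge x y → c (f x) (f y) ≡ col) ×
    (∀ x y z w → LEdge x y → LEdge z w → ¬ Cross (f x) (f y) (f z) (f w))

{-# OPTIONS --safe #-}
-- Say the well-split K_{L,R} has colour col and L ≺ R. Inside L, repeatedly remove the sources:
-- the points that are not the larger end of a col-edge from a smaller remaining point. Sources
-- span no col-edge, so unless some layer has 2n points, n − 1 layers hold at most
-- (n − 1)(2n − 1) < 2n² points, and a surviving point is the top of an increasing col-path
-- u₀ < … < uₙ₋₁ through the removed layers; likewise in R. Both outcomes give a ladder on 2n
-- increasing points, with uᵢ on the i-th and vᵢ on the (2n − 1 − i)-th of them: from 2n points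
-- spanning no col-edge (a clique of the other colour), or from the two paths joined by the
-- monochromatic K_{L,R}. Every ladder edge is then a side of the convex hull of these 2n points
-- or a chord with label sum 2n − 1, and no two such edges cross.
module Submission where

open import Defs
open import Data.Nat as ℕ using (ℕ; zero; suc; _+_; _≤_; _*_)
import Data.Nat.Properties as ℕ
open import Data.Nat.Tactic.RingSolver using (solve-∀)
open import Algebra.Properties.CommutativeSemigroup ℕ.+-commutativeSemigroup using (x∙yz≈y∙xz)
open import Data.Fin as Fin using (Fin; toℕ; _<_; _<?_; _↑ˡ_; _↑ʳ_; opposite; inject≤)
open import Data.Fin.Properties
  using (toℕ<n; toℕ≤pred[n]; toℕ-↑ˡ; toℕ-↑ʳ; ↑ˡ-injective; ↑ʳ-injective;
         opposite-prop; opposite-involutive; toℕ-inject≤; <-cmp; <-irrefl; <-asym; <-trans)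
open import Data.Fin.Subset using (Subset; _∈_; ∣_∣)
open import Data.Bool as Bool using (Bool; true; false; not)
open import Data.Bool.Properties using (¬-not)
open import Data.Product as Product using (_×_; _,_; proj₁; proj₂)
open import Data.Sum as Sum using (_⊎_; inj₁; inj₂)
open import Data.Empty using (⊥; ⊥-elim)
open import Data.List using (List; []; _∷_; length; map; filter; lookup)
open import Data.List.Properties using (length-map)
open import Data.List.Membership.Propositional using (find) renaming (_∈_ to _∈ₗ_)
open import Data.List.Membership.Propositional.Properties using (∈-filter⁻; ∈-lookup)
open import Data.List.Relation.Unary.All as All using (All; []; _∷_)
import Data.List.Relation.Unary.All.Properties as All
open import Data.List.Relation.Unary.Any as Any using (Any; here; any?)
open import Data.List.Relation.Unary.AllPairs as AllPairs using (AllPairs; []; _∷_)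
import Data.List.Relation.Unary.AllPairs.Properties as AllPairs
open import Data.Vec.Base as Vec using ([]; _∷_)
import Data.Vec.Functional as Vector
open import Function using (_∘_)
open import Function.Definitions using (Injective)
open import Level using (0ℓ)
open import Relation.Binary.Core using (_Preserves_⟶_)
open import Relation.Binary.Definitions using (tri<; tri≈; tri>)
open import Relation.Binary.PropositionalEquality
  using (_≡_; _≢_; refl; sym; trans; cong; cong₂; subst; subst₂; module ≡-Reasoning)
open import Relation.Nullary using (¬_; yes; no; does; _×-dec_)
open import Relation.Unary using (Pred; Decidable)
open import Relation.Unary.Properties using (∁?)

private
  variable
    m N : ℕ
    p q r s x : Fin m

Consecutive : Fin m → Fin m → Set
Consecutive i j = toℕ j ≡ suc (toℕ i)

Side : Fin m → Fin m → Set
Side p q = Consecutive p q ⊎ Consecutive q p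

private
  nothing-between : ∀ {a b} → a ℕ.< b → b ℕ.< suc a → ⊥
  nothing-between a<b b<1+a = ℕ.<⇒≱ a<b (ℕ.s≤s⁻¹ b<1+a)

  consecutive-< : Consecutive p q → p < q
  consecutive-< {p = p} p⋯q = subst (toℕ p ℕ.<_) (sym p⋯q) (ℕ.n<1+n (toℕ p))

Out-swap : Out x p q → Out x q p
Out-swap = Sum.map Product.swap Product.swap

Cross-swapʳ : Cross p q r s → Cross p q s r
Cross-swapʳ = Sum.swap ∘ Sum.map Product.swap Product.swap

Btw-consecutive : Consecutive p q → ¬ Btw x p q
Btw-consecutive {x = x} p⋯q (inj₁ (p<x , x<q)) = nothing-between p<x (subst (toℕ x ℕ.<_) p⋯q x<q)
Btw-consecutive p⋯q (inj₂ (q<x , x<p)) = <-asym x<p (<-trans (consecutive-< p⋯q) q<x)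

Btw-side : Side p q → ¬ Btw x p q
Btw-side (inj₁ p⋯q) = Btw-consecutive p⋯q
Btw-side (inj₂ q⋯p) = Btw-consecutive q⋯p ∘ Sum.swap

side-crosses-nothing : Side p q → ¬ Cross p q r s
side-crosses-nothing side (inj₁ (btw , _)) = Btw-side side btw
side-crosses-nothing side (inj₂ (_ , btw)) = Btw-side side btw

-- Consecutive labels r, s lie on the same side of every other label.
Btw-Out-consecutive : p < r → r < q → Consecutive r s → ¬ Out s p q
Btw-Out-consecutive p<r r<q r⋯s (inj₁ (s<p , _)) = <-asym p<r (<-trans (consecutive-< r⋯s) s<p)
Btw-Out-consecutive {q = q} p<r r<q r⋯s (inj₂ (_ , q<s)) =
  nothing-between r<q (subst (toℕ q ℕ.<_) r⋯s q<s)

Out-Btw-consecutive : p < s → s < q → Consecutive r s → ¬ Out r p q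
Out-Btw-consecutive {p = p} p<s s<q r⋯s (inj₁ (r<p , _)) =
  nothing-between r<p (subst (toℕ p ℕ.<_) r⋯s p<s)
Out-Btw-consecutive p<s s<q r⋯s (inj₂ (_ , q<r)) = <-asym (<-trans s<q q<r) (consecutive-< r⋯s)

consecutive-crosses-nothing : Consecutive r s → ¬ Cross p q r s
consecutive-crosses-nothing r⋯s (inj₁ (inj₁ (p<r , r<q) , out)) =
  Btw-Out-consecutive p<r r<q r⋯s out
consecutive-crosses-nothing r⋯s (inj₁ (inj₂ (q<r , r<p) , out)) =
  Btw-Out-consecutive q<r r<p r⋯s (Out-swap out)
consecutive-crosses-nothing r⋯s (inj₂ (out , inj₁ (p<s , s<q))) =
  Out-Btw-consecutive p<s s<q r⋯s out
consecutive-crosses-nothing r⋯s (inj₂ (out , inj₂ (q<s , s<p))) =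
  Out-Btw-consecutive q<s s<p r⋯s (Out-swap out)

nothing-crosses-side : Side r s → ¬ Cross p q r s
nothing-crosses-side (inj₁ r⋯s) = consecutive-crosses-nothing r⋯s
nothing-crosses-side (inj₂ s⋯r) = consecutive-crosses-nothing s⋯r ∘ Cross-swapʳ

Btw-Out-sum : p < r → r < q → Out s p q → toℕ p + toℕ q ≢ toℕ r + toℕ s
Btw-Out-sum {p = p} {q = q} p<r r<q (inj₁ (s<p , _)) p+q≡r+s =
  ℕ.<⇒≢ (ℕ.+-mono-< r<q s<p) (trans (sym p+q≡r+s) (ℕ.+-comm (toℕ p) (toℕ q)))
Btw-Out-sum p<r r<q (inj₂ (_ , q<s)) = ℕ.<⇒≢ (ℕ.+-mono-< p<r q<s)

equal-sums-noncrossing : toℕ p + toℕ q ≡ toℕ r + toℕ s → ¬ Cross p q r s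
equal-sums-noncrossing e (inj₁ (inj₁ (p<r , r<q) , out)) = Btw-Out-sum p<r r<q out e
equal-sums-noncrossing {p = p} {q} e (inj₁ (inj₂ (q<r , r<p) , out)) =
  Btw-Out-sum q<r r<p (Out-swap out) (trans (ℕ.+-comm (toℕ q) (toℕ p)) e)
equal-sums-noncrossing {r = r} {s} e (inj₂ (out , inj₁ (p<s , s<q))) =
  Btw-Out-sum p<s s<q out (trans e (ℕ.+-comm (toℕ r) (toℕ s)))
equal-sums-noncrossing {p = p} {q} {r} {s} e (inj₂ (out , inj₂ (q<s , s<p))) =
  Btw-Out-sum q<s s<p (Out-swap out)
    (trans (ℕ.+-comm (toℕ q) (toℕ p)) (trans e (ℕ.+-comm (toℕ r) (toℕ s))))

-- Chords with a common label sum σ are nested, and a side of the polygon crosses nothing.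
ZigzagEdge : ℕ → Fin m → Fin m → Set
ZigzagEdge σ p q = Side p q ⊎ toℕ p + toℕ q ≡ σ

zigzag-noncrossing : ∀ {σ} → ZigzagEdge σ p q → ZigzagEdge σ r s → ¬ Cross p q r s
zigzag-noncrossing (inj₁ side) _ = side-crosses-nothing side
zigzag-noncrossing (inj₂ _) (inj₁ side) = nothing-crosses-side side
zigzag-noncrossing (inj₂ pq≡σ) (inj₂ rs≡σ) = equal-sums-noncrossing (trans pq≡σ (sym rs≡σ))

toℕ-opposite-sum : (i : Fin m) → toℕ i + toℕ (opposite i) ≡ ℕ.pred m
toℕ-opposite-sum {suc m} i = begin
  toℕ i + toℕ (opposite i) ≡⟨ cong (toℕ i +_) (opposite-prop i) ⟩
  toℕ i + (m ℕ.∸ toℕ i)    ≡⟨ ℕ.m+[n∸m]≡n (toℕ≤pred[n] i) ⟩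
  m                        ∎
  where open ≡-Reasoning

opposite-injective : Injective _≡_ _≡_ (opposite {m})
opposite-injective {x = i} {j} e = begin
  i                     ≡⟨ opposite-involutive i ⟨
  opposite (opposite i) ≡⟨ cong opposite e ⟩
  opposite (opposite j) ≡⟨ opposite-involutive j ⟩
  j                     ∎
  where open ≡-Reasoning

opposite-reverses-consecutive : Consecutive p q → Consecutive (opposite q) (opposite p)
opposite-reverses-consecutive {m} {p} {q} p⋯q = ℕ.+-cancelˡ-≡ (toℕ p) _ _ (begin
  toℕ p + toℕ (opposite p)             ≡⟨ toℕ-opposite-sum p ⟩
  ℕ.pred m                             ≡⟨ toℕ-opposite-sum q ⟨
  toℕ q + toℕ (opposite q)             ≡⟨ cong (_+ toℕ (opposite q)) p⋯q ⟩
  suc (toℕ p + toℕ (opposite q))       ≡⟨ ℕ.+-suc (toℕ p) (toℕ (opposite q)) ⟨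
  toℕ p + suc (toℕ (opposite q))       ∎)
  where open ≡-Reasoning

↑ˡ<↑ʳ : ∀ {n} (i : Fin m) (j : Fin n) → i ↑ˡ n < m ↑ʳ j
↑ˡ<↑ʳ {m} {n} i j = subst₂ ℕ._<_ (sym (toℕ-↑ˡ i n)) (sym (toℕ-↑ʳ m j))
  (ℕ.<-≤-trans (toℕ<n i) (ℕ.m≤m+n m (toℕ j)))

position : ∀ {n} → LVert n → Fin (n + n)
position {n} (false , i) = i ↑ˡ n
position {n} (true  , i) = n ↑ʳ opposite i

position-injective : ∀ {n} → Injective _≡_ _≡_ (position {n})
position-injective {n} {false , i} {false , j} e = cong (false ,_) (↑ˡ-injective n i j e)
position-injective {n} {true  , i} {true  , j} e =
  cong (true ,_) (opposite-injective (↑ʳ-injective n _ _ e))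
position-injective {n} {false , i} {true  , j} e = ⊥-elim (<-irrefl e (↑ˡ<↑ʳ i (opposite j)))
position-injective {n} {true  , i} {false , j} e = ⊥-elim (<-irrefl (sym e) (↑ˡ<↑ʳ j (opposite i)))

position-zigzag : ∀ {n} {x y : LVert n} → LEdge x y →
                  ZigzagEdge (n + ℕ.pred n) (position x) (position y)
position-zigzag {n} (rail false i {j} i⋯j) = inj₁ (inj₁ (begin
  toℕ (j ↑ˡ n)        ≡⟨ toℕ-↑ˡ j n ⟩
  toℕ j               ≡⟨ i⋯j ⟩
  suc (toℕ i)         ≡⟨ cong suc (toℕ-↑ˡ i n) ⟨
  suc (toℕ (i ↑ˡ n))  ∎))
  where open ≡-Reasoning
position-zigzag {n} (rail true i {j} i⋯j) = inj₁ (inj₂ (begin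
  toℕ (n ↑ʳ opposite i)        ≡⟨ toℕ-↑ʳ n (opposite i) ⟩
  n + toℕ (opposite i)         ≡⟨ cong (n +_) (opposite-reverses-consecutive i⋯j) ⟩
  n + suc (toℕ (opposite j))   ≡⟨ ℕ.+-suc n (toℕ (opposite j)) ⟩
  suc (n + toℕ (opposite j))   ≡⟨ cong suc (toℕ-↑ʳ n (opposite j)) ⟨
  suc (toℕ (n ↑ʳ opposite j))  ∎))
  where open ≡-Reasoning
position-zigzag {n} (rung i) = inj₂ (begin
  toℕ (i ↑ˡ n) + toℕ (n ↑ʳ opposite i) ≡⟨ cong₂ _+_ (toℕ-↑ˡ i n) (toℕ-↑ʳ n (opposite i)) ⟩
  toℕ i + (n + toℕ (opposite i))       ≡⟨ x∙yz≈y∙xz (toℕ i) n (toℕ (opposite i)) ⟩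
  n + (toℕ i + toℕ (opposite i))       ≡⟨ cong (n +_) (toℕ-opposite-sum i) ⟩
  n + ℕ.pred n                         ∎)
  where open ≡-Reasoning

position-noncrossing : ∀ {n} {x y z w : LVert n} → LEdge x y → LEdge z w →
                       ¬ Cross (position x) (position y) (position z) (position w)
position-noncrossing xy zw = zigzag-noncrossing (position-zigzag xy) (position-zigzag zw)

LEdge-irreflexive : ∀ {n} {x y : LVert n} → LEdge x y → x ≢ y
LEdge-irreflexive (rail s i i⋯j) refl = ℕ.<⇒≢ (ℕ.n<1+n (toℕ i)) i⋯j
LEdge-irreflexive (rung i) ()

module OrderCompatible {A : Set} {g : A → Fin m} (g-injective : Injective _≡_ _≡_ g)
                       {f : A → Fin N} (f-mono : ∀ a b → g a < g b → f a < f b) where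

  <-reflect : ∀ {a b} → f a < f b → g a < g b
  <-reflect {a} {b} fa<fb with <-cmp (g a) (g b)
  ... | tri< ga<gb _ _ = ga<gb
  ... | tri≈ _ ga≡gb _ = ⊥-elim (<-irrefl (cong f (g-injective ga≡gb)) fa<fb)
  ... | tri> _ _ gb<ga = ⊥-elim (<-asym fa<fb (f-mono b a gb<ga))

  f-injective : Injective _≡_ _≡_ f
  f-injective {a} {b} fa≡fb with <-cmp (g a) (g b)
  ... | tri< ga<gb _ _ = ⊥-elim (<-irrefl fa≡fb (f-mono a b ga<gb))
  ... | tri≈ _ ga≡gb _ = g-injective ga≡gb
  ... | tri> _ _ gb<ga = ⊥-elim (<-irrefl (sym fa≡fb) (f-mono b a gb<ga))

  Btw-reflect : ∀ {a b d} → Btw (f a) (f b) (f d) → Btw (g a) (g b) (g d)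
  Btw-reflect = Sum.map (Product.map <-reflect <-reflect) (Product.map <-reflect <-reflect)

  Out-reflect : ∀ {a b d} → Out (f a) (f b) (f d) → Out (g a) (g b) (g d)
  Out-reflect = Sum.map (Product.map <-reflect <-reflect) (Product.map <-reflect <-reflect)

  Cross-reflect : ∀ {a b d e} → Cross (f a) (f b) (f d) (f e) → Cross (g a) (g b) (g d) (g e)
  Cross-reflect = Sum.map (Product.map Btw-reflect Out-reflect) (Product.map Out-reflect Btw-reflect)

ladder-embedding : ∀ {n} (c : Colouring N) (col : Bool) (f : LVert n → Fin N) →
                   (∀ x y → position x < position y → f x < f y) →
                   (∀ {x y} → LEdge x y → c (f x) (f y) ≡ col) → HasMonoNCLadder c n
ladder-embedding c col f f-mono coloured =
  col , f , f-injective , (λ _ _ → coloured) ,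
  λ _ _ _ _ xy zw → position-noncrossing xy zw ∘ Cross-reflect
  where open OrderCompatible position-injective f-mono

record IncreasingPath (c : Colouring N) (col : Bool) (S : List (Fin N)) (m : ℕ) : Set where
  field
    vertex     : Fin m → Fin N
    increasing : vertex Preserves _<_ ⟶ _<_
    coloured   : ∀ {i j} → Consecutive i j → c (vertex i) (vertex j) ≡ col
    members    : ∀ i → vertex i ∈ₗ S

record IncreasingIndependent (c : Colouring N) (col : Bool) (m : ℕ) : Set where
  field
    vertex     : Fin m → Fin N
    increasing : vertex Preserves _<_ ⟶ _<_
    avoids     : ∀ {i j} → i < j → c (vertex i) (vertex j) ≢ col

module _ {c : Colouring N} (c-sym : Symmetric c) {col : Bool} where

  ladder-from-independent : ∀ {n} → IncreasingIndependent c col (n + n) → HasMonoNCLadder c n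
  ladder-from-independent I = ladder-embedding c (not col) (vertex ∘ position) (λ _ _ → increasing)
    (λ xy → other-colour (LEdge-irreflexive xy ∘ position-injective))
    where
    open IncreasingIndependent I
    other-colour : ∀ {i j} → i ≢ j → c (vertex i) (vertex j) ≡ not col
    other-colour {i} {j} i≢j with <-cmp i j
    ... | tri< i<j _ _ = ¬-not (avoids i<j)
    ... | tri≈ _ i≡j _ = ⊥-elim (i≢j i≡j)
    ... | tri> _ _ j<i = trans (c-sym _ _) (¬-not (avoids j<i))

  ladder-from-paths : ∀ {n S T} (u : IncreasingPath c col S n) (w : IncreasingPath c col T n) →
    (∀ i j → IncreasingPath.vertex u i < IncreasingPath.vertex w j) →
    (∀ i j → c (IncreasingPath.vertex u i) (IncreasingPath.vertex w j) ≡ col) →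
    HasMonoNCLadder c n
  ladder-from-paths {n} u w u<w uw-col = ladder-embedding c col f f-mono coloured
    where
    module U = IncreasingPath u
    module W = IncreasingPath w

    f : LVert n → Fin N
    f (false , i) = U.vertex i
    f (true  , i) = W.vertex (opposite i)

    f-mono : ∀ x y → position x < position y → f x < f y
    f-mono (false , i) (false , j) p<q = U.increasing (subst₂ ℕ._<_ (toℕ-↑ˡ i n) (toℕ-↑ˡ j n) p<q)
    f-mono (true  , i) (true  , j) p<q =
      W.increasing (ℕ.+-cancelˡ-< n _ _
        (subst₂ ℕ._<_ (toℕ-↑ʳ n (opposite i)) (toℕ-↑ʳ n (opposite j)) p<q))
    f-mono (false , i) (true  , j) _   = u<w i (opposite j)
    f-mono (true  , i) (false , j) p<q = ⊥-elim (<-asym p<q (↑ˡ<↑ʳ j (opposite i)))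

    coloured : ∀ {x y} → LEdge x y → c (f x) (f y) ≡ col
    coloured (rail false i i⋯j) = U.coloured i⋯j
    coloured (rail true  i i⋯j) = trans (c-sym _ _) (W.coloured (opposite-reverses-consecutive i⋯j))
    coloured (rung i)           = uw-col i (opposite i)

length-filter-∁ : ∀ {A : Set} {P : Pred A 0ℓ} (P? : Decidable P) (xs : List A) →
                  length (filter P? xs) + length (filter (∁? P?) xs) ≡ length xs
length-filter-∁ P? [] = refl
length-filter-∁ P? (x ∷ xs) with does (P? x)
... | true  = cong suc (length-filter-∁ P? xs)
... | false = trans (ℕ.+-suc _ _) (cong suc (length-filter-∁ P? xs))

lookup-AllPairs : ∀ {A : Set} {R : A → A → Set} {xs : List A} → AllPairs R xs →
                  ∀ {i j} → i < j → R (lookup xs i) (lookup xs j)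
lookup-AllPairs (x~xs ∷ _)   {Fin.zero}  {Fin.suc j} _   = All.lookup x~xs (∈-lookup j)
lookup-AllPairs (_ ∷ xs~xs) {Fin.suc i} {Fin.suc j} i<j = lookup-AllPairs xs~xs (ℕ.s<s⁻¹ i<j)

module _ (c : Colouring N) (col : Bool) where

  singleton-path : ∀ {S x} → x ∈ₗ S → IncreasingPath c col S 1
  singleton-path {x = x} x∈S = record
    { vertex     = λ _ → x
    ; increasing = λ { {Fin.zero} {Fin.zero} () }
    ; coloured   = λ { {Fin.zero} {Fin.zero} () }
    ; members    = λ { Fin.zero → x∈S }
    }

  path-∷ : ∀ {S m x} (P : IncreasingPath c col S (suc m)) → x ∈ₗ S →
           let open IncreasingPath P in
           x < vertex Fin.zero → c x (vertex Fin.zero) ≡ col → IncreasingPath c col S (suc (suc m))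
  path-∷ {x = x} P x∈S x<y xy-col = record
    { vertex     = x Vector.∷ vertex
    ; increasing = ∷-increasing
    ; coloured   = ∷-coloured
    ; members    = λ { Fin.zero → x∈S ; (Fin.suc i) → members i }
    }
    where
    open IncreasingPath P
    ∷-increasing : (x Vector.∷ vertex) Preserves _<_ ⟶ _<_
    ∷-increasing {Fin.zero}  {Fin.suc Fin.zero}    _   = x<y
    ∷-increasing {Fin.zero}  {Fin.suc (Fin.suc j)} _   = <-trans x<y (increasing ℕ.z<s)
    ∷-increasing {Fin.suc i} {Fin.suc j}           i<j = increasing (ℕ.s<s⁻¹ i<j)
    ∷-coloured : ∀ {i j} → Consecutive i j → c ((x Vector.∷ vertex) i) ((x Vector.∷ vertex) j) ≡ col
    ∷-coloured {Fin.zero}  {Fin.suc Fin.zero} _   = xy-col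
    ∷-coloured {Fin.suc i} {Fin.suc j}        i⋯j = coloured (ℕ.suc-injective i⋯j)

  path-weaken : ∀ {S T m} → (∀ {x} → x ∈ₗ S → x ∈ₗ T) →
                IncreasingPath c col S m → IncreasingPath c col T m
  path-weaken S⊆T P = record { IncreasingPath P ; members = S⊆T ∘ IncreasingPath.members P }

  independent-from-list : ∀ {xs m} → AllPairs (λ x y → x < y × c x y ≢ col) xs → m ≤ length xs →
                          IncreasingIndependent c col m
  independent-from-list {xs} xs~xs m≤∣xs∣ = record
    { vertex     = vertex
    ; increasing = proj₁ ∘ vertex-pair
    ; avoids     = proj₂ ∘ vertex-pair
    }
    where
    vertex : Fin _ → Fin N
    vertex i = lookup xs (inject≤ i m≤∣xs∣)
    vertex-pair : ∀ {i j} → i < j → vertex i < vertex j × c (vertex i) (vertex j) ≢ col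
    vertex-pair {i} {j} i<j = lookup-AllPairs xs~xs
      (subst₂ ℕ._<_ (sym (toℕ-inject≤ i m≤∣xs∣)) (sym (toℕ-inject≤ j m≤∣xs∣)) i<j)

  ReachedFrom : List (Fin N) → Fin N → Set
  ReachedFrom S y = Any (λ x → x < y × c x y ≡ col) S

  reachedFrom? : ∀ S → Decidable (ReachedFrom S)
  reachedFrom? S y = any? (λ x → x <? y ×-dec c x y Bool.≟ col) S

  reached sources : List (Fin N) → List (Fin N)
  reached S = filter (reachedFrom? S) S
  sources S = filter (∁? (reachedFrom? S)) S

  unreached-independent : ∀ {S xs} → AllPairs _<_ xs → All (λ y → y ∈ₗ S × ¬ ReachedFrom S y) xs →
                          AllPairs (λ x y → x < y × c x y ≢ col) xs
  unreached-independent []            []                = []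
  unreached-independent (x<xs ∷ xs↑) ((x∈S , _) ∷ xs-unreached) =
    All.zipWith (λ (x<y , (_ , y-unreached)) → x<y , λ xy≡col →
                   y-unreached (Any.map (λ { refl → x<y , xy≡col }) x∈S))
                (x<xs , xs-unreached)
    ∷ unreached-independent xs↑ xs-unreached

  sources-independent : ∀ {S} → AllPairs _<_ S → AllPairs (λ x y → x < y × c x y ≢ col) (sources S)
  sources-independent {S} S↑ = unreached-independent (AllPairs.filter⁺ _ S↑)
    (All.tabulate (∈-filter⁻ (∁? (reachedFrom? S)) {xs = S}))

  extend-path : ∀ {S m} → IncreasingPath c col (reached S) (suc m) →
                IncreasingPath c col S (suc (suc m))
  extend-path {S} P =
    let x , x∈S , x<y , xy-col = find (proj₂ (∈-reached (IncreasingPath.members P Fin.zero)))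
    in  path-∷ (path-weaken (proj₁ ∘ ∈-reached) P) x∈S x<y xy-col
    where
    ∈-reached : ∀ {y} → y ∈ₗ reached S → y ∈ₗ S × ReachedFrom S y
    ∈-reached = ∈-filter⁻ (reachedFrom? S) {xs = S}

  reached-bound : ∀ {n k} S → length (sources S) ≤ k → suc n * k ℕ.< length S →
                  n * k ℕ.< length (reached S)
  reached-bound {n} {k} S few bound = ℕ.+-cancelˡ-< k _ _ (begin-strict
    k + n * k                               <⟨ bound ⟩
    length S                                ≡⟨ length-filter-∁ (reachedFrom? S) S ⟨
    length (reached S) + length (sources S) ≤⟨ ℕ.+-monoʳ-≤ (length (reached S)) few ⟩
    length (reached S) + k                  ≡⟨ ℕ.+-comm (length (reached S)) k ⟩
    k + length (reached S)                  ∎)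
    where open ℕ.≤-Reasoning

  ordered-ramsey : ∀ n k (S : List (Fin N)) → AllPairs _<_ S → n * k ℕ.< length S →
                   IncreasingPath c col S (suc n) ⊎ IncreasingIndependent c col (suc k)
  ordered-ramsey zero    k (x ∷ _) _ _ = inj₁ (singleton-path (here refl))
  ordered-ramsey (suc n) k S S↑ bound with suc k ℕ.≤? length (sources S)
  ... | yes many = inj₂ (independent-from-list (sources-independent S↑) many)
  ... | no  few  = Sum.map₁ extend-path
    (ordered-ramsey n k (reached S) (AllPairs.filter⁺ _ S↑) (reached-bound {n} S (ℕ.≮⇒≥ few) bound))

elements : Subset N → List (Fin N)
elements []          = []
elements (true  ∷ s) = Fin.zero ∷ map Fin.suc (elements s)
elements (false ∷ s) = map Fin.suc (elements s)

length-elements : (s : Subset N) → length (elements s) ≡ ∣ s ∣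
length-elements []          = refl
length-elements (true  ∷ s) = cong suc (trans (length-map Fin.suc (elements s)) (length-elements s))
length-elements (false ∷ s) = trans (length-map Fin.suc (elements s)) (length-elements s)

elements-∈ : (s : Subset N) → All (_∈ s) (elements s)
elements-∈ []          = []
elements-∈ (true  ∷ s) = Vec.here ∷ All.map⁺ (All.map Vec.there (elements-∈ s))
elements-∈ (false ∷ s) = All.map⁺ (All.map Vec.there (elements-∈ s))

elements-sorted : (s : Subset N) → AllPairs _<_ (elements s)
elements-sorted []          = []
elements-sorted (true  ∷ s) =
  All.map⁺ (All.universal (λ _ → ℕ.z<s) (elements s)) ∷
  AllPairs.map⁺ (AllPairs.map ℕ.s<s (elements-sorted s))
elements-sorted (false ∷ s) = AllPairs.map⁺ (AllPairs.map ℕ.s<s (elements-sorted s))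

ramsey-bound : ∀ n → n * (n + suc n) ℕ.< 2 * (suc n * suc n)
ramsey-bound n = subst (suc (n * (n + suc n)) ≤_) (sym (expand n)) (ℕ.m≤m+n _ (3 * n + 1))
  where
  expand : ∀ n → 2 * (suc n * suc n) ≡ suc (n * (n + suc n)) + (3 * n + 1)
  expand = solve-∀

MonoBip-swap : ∀ {c : Colouring N} {col L R} → Symmetric c → MonoBip c col L R → MonoBip c col R L
MonoBip-swap c-sym LR-col u v u∈R v∈L = trans (c-sym u v) (LR-col v u v∈L u∈R)

ladder-from-split : ∀ n {c : Colouring N} → Symmetric c → ∀ {col L R} → L ≺ R → MonoBip c col L R →
                    ∣ L ∣ ≡ 2 * (suc n * suc n) → ∣ R ∣ ≡ 2 * (suc n * suc n) →
                    HasMonoNCLadder c (suc n)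
ladder-from-split n {c} c-sym {col} {L} {R} L≺R LR-col ∣L∣ ∣R∣
  with ordered-ramsey c col n (n + suc n) (elements L) (elements-sorted L) (large L ∣L∣)
     | ordered-ramsey c col n (n + suc n) (elements R) (elements-sorted R) (large R ∣R∣)
  where
  large : ∀ S → ∣ S ∣ ≡ 2 * (suc n * suc n) → n * (n + suc n) ℕ.< length (elements S)
  large S ∣S∣ = subst (n * (n + suc n) ℕ.<_) (sym (trans (length-elements S) ∣S∣)) (ramsey-bound n)
... | inj₂ I      | _      = ladder-from-independent c-sym I
... | inj₁ _      | inj₂ I = ladder-from-independent c-sym I
... | inj₁ u      | inj₁ w = ladder-from-paths c-sym u w
  (λ i j → L≺R _ _ (in-L i) (in-R j)) (λ i j → LR-col _ _ (in-L i) (in-R j))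
  where
  in-L : ∀ i → IncreasingPath.vertex u i ∈ L
  in-L i = All.lookup (elements-∈ L) (IncreasingPath.members u i)
  in-R : ∀ j → IncreasingPath.vertex w j ∈ R
  in-R j = All.lookup (elements-∈ R) (IncreasingPath.members w j)

lemma2p3 : (n N : ℕ) → 1 ≤ n → (c : Colouring N) → Symmetric c →
    HasMonoWellSplit c (2 * (n * n)) (2 * (n * n)) → HasMonoNCLadder c n
lemma2p3 (suc n) N _ c c-sym (col , L , R , ∣L∣ , ∣R∣ , inj₁ L≺R , LR-col) =
  ladder-from-split n c-sym L≺R LR-col ∣L∣ ∣R∣
lemma2p3 (suc n) N _ c c-sym (col , L , R , ∣L∣ , ∣R∣ , inj₂ R≺L , LR-col) =
  ladder-from-split n c-sym R≺L (MonoBip-swap c-sym LR-col) ∣R∣ ∣L∣
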